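{- Every flower group has a compatible system of generators.
   Context: A cyclic subgroup $H$ of a group $G$ is a $\mu$-subgroup if it is not contained in any cyclic subgroup of $G$ other than $H$ itself. A finite noncyclic group $G$, whose set of $\mu$-subgroups is $\{C_1,\ldots,C_k\}$, is a flower group if there is a subgroup $C_0$ of $G$ with $C_i\cap C_j=C_0$ for all $1\le i<j\le k$; $C_0$ is the pistil and $C_1,\ldots,C_k$ the petals; with $c_i=|C_i|$ ($0\le i\le k$), $(c_0;c_1,\ldots,c_k)$ is the type of $G$. A compatible system of generators for $G$ is a tuple $(g_1,\ldots,g_k)$ where $g_i$ generates $C_i$ for each $1\le i\le k$ and $g_i^{c_i/c_0}=g_j^{c_j/c_0}$ for all $1\le i<j\le k$. -}

module Defs where

open import Level using (0ℓ)
open import Data.Nat using (ℕ; zero; suc; _/_)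
open import Data.Fin using (Fin)
open import Data.Fin.Properties using (_≟_)
open import Data.Fin.Subset using (Subset; _∈_; _⊆_; ⊤)
open import Data.Product using (Σ; ∃; _×_)
open import Relation.Binary.PropositionalEquality using (_≡_)
open import Relation.Nullary using (¬_)
open import Algebra.Core using (Op₁; Op₂)
open import Algebra.Structures using (IsGroup)
open import Function.Bundles using (_⇔_)

-- A finite group, presented (up to isomorphism) on the carrier Fin order,
-- with propositional equality.
record FiniteGroup : Set where
  field
    order   : ℕ
    _∙_     : Op₂ (Fin order)
    ε       : Fin order
    _⁻¹     : Op₁ (Fin order)
    isGroup : IsGroup _≡_ _∙_ ε _⁻¹

module _ (G : FiniteGroup) where
  open FiniteGroup G

  pow : Fin order → ℕ → Fin order
  pow g zero    = ε
  pow g (suc m) = g ∙ pow g m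

  IsSubgroup : Subset order → Set
  IsSubgroup S = (ε ∈ S)
               × (∀ {x y} → x ∈ S → y ∈ S → (x ∙ y) ∈ S)
               × (∀ {x} → x ∈ S → (x ⁻¹) ∈ S)

  -- S is the cyclic subgroup ⟨g⟩ = { g^m } (finite group: natural powers suffice)
  GeneratedBy : Fin order → Subset order → Set
  GeneratedBy g S = ∀ x → (x ∈ S) ⇔ (∃ λ m → pow g m ≡ x)

  IsCyclicSubgroup : Subset order → Set
  IsCyclicSubgroup S = ∃ λ g → GeneratedBy g S

  IsMuSubgroup : Subset order → Set
  IsMuSubgroup H = IsCyclicSubgroup H
                 × (∀ K → IsCyclicSubgroup K → H ⊆ K → K ≡ H)

  IsCyclicGroup : Set
  IsCyclicGroup = IsCyclicSubgroup ⊤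

-- natural-number division, with m ÷ 0 = 0 (only used with nonzero divisor)
_÷_ : ℕ → ℕ → ℕ
m ÷ zero  = zero
m ÷ suc n = m / suc n

-- A subgroup D of a cyclic group ⟨h⟩ of order a is generated by h ^ (a ÷ ∣D∣). So if h
-- generates one petal, z = h ^ (∣C i∣ ÷ ∣C₀∣) generates the pistil C₀. For any other petal
-- B = ⟨h′⟩, the pistil is also generated by w = h′ ^ (∣B∣ ÷ ∣C₀∣); hence z = w ^ t, and t is
-- coprime to ∣C₀∣ because z and w have the same order. Shifting t by a multiple of ∣C₀∣ to
-- some t′ coprime to ∣B∣ gives a generator h′ ^ t′ of B whose (∣B∣ ÷ ∣C₀∣)-th power is
-- w ^ t′ = w ^ t = z.
module Submission where

open import Defs
open import Level using (0ℓ)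
open import Algebra.Bundles using (Group)
open import Data.Nat
  using (ℕ; zero; suc; pred; _+_; _*_; _^_; _<_; _≤_; z≤n; s≤s; _%_; _/_
        ; NonZero; >-nonZero; >-nonZero⁻¹; ≢-nonZero⁻¹; n>1⇒nonTrivial)
open import Data.Nat.Properties
open import Data.Nat.Divisibility
open import Data.Nat.DivMod using (m≡m%n+[m/n]*n; m%n<n; m*n/n≡m)
open import Data.Nat.GCD using (gcd; gcd[m,n]∣m; gcd[m,n]∣n; gcd[m,n]≡0⇒m≡0; module Bézout)
open import Data.Nat.Coprimality as Coprimality
  using (Coprime; coprime?; coprime-divisor; coprime-Bézout; gcd≡1⇒coprime)
open import Data.Nat.Induction using (<-rec)
open import Data.Fin using (Fin; zero; suc; toℕ; fromℕ<)
open import Data.Fin.Properties as Fin using (pigeonhole; toℕ-injective; toℕ<n; toℕ-fromℕ<)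
open import Data.Fin.Subset using (Subset; _∈_; _∉_; _⊆_; _∩_; _-_; ∣_∣; inside; outside)
open import Data.Fin.Subset.Properties
  using (_∈?_; p─q⊆p; x∈p∧x≢y⇒x∈p-y; p─⊥≡p; Empty-unique; ∣⊥∣≡0; p∩q⊆p)
open import Data.Vec.Base using (_∷_; here; there)
open import Data.Product using (Σ; ∃; ∃₂; _×_; _,_; proj₁; proj₂)
open import Data.Sum using (inj₁; inj₂)
open import Data.Empty using (⊥-elim)
open import Function.Base using (_∘_)
open import Function.Bundles using (_⇔_; mk⇔; Equivalence)
open import Function.Definitions using (Injective)
open import Relation.Nullary using (¬_; yes; no; contradiction)
open import Relation.Nullary.Decidable using (_×-dec_)
open import Relation.Unary using (Decidable)
open import Relation.Binary.Definitions using (tri<; tri≈; tri>)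
open import Relation.Binary.PropositionalEquality
  using (_≡_; _≢_; refl; sym; trans; cong; cong₂; subst; subst₂; module ≡-Reasoning)

-- Number theory

coprime-∣ˡ : ∀ {d m n} → d ∣ m → Coprime m n → Coprime d n
coprime-∣ˡ d∣m m⊥n (i∣d , i∣n) = m⊥n (∣-trans i∣d d∣m , i∣n)

coprime-*ʳ : ∀ {m n o} → Coprime m n → Coprime m o → Coprime m (n * o)
coprime-*ʳ m⊥n m⊥o (i∣m , i∣n*o) = m⊥o (i∣m , coprime-divisor (coprime-∣ˡ i∣m m⊥n) i∣n*o)

coprime-^-*ʳ : ∀ {m n o} → Coprime m n → Coprime m o → ∀ k → Coprime m (n ^ k * o)
coprime-^-*ʳ {m} {n} {o} m⊥n m⊥o zero = subst (Coprime m) (sym (*-identityˡ o)) m⊥o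
coprime-^-*ʳ {m} {n} {o} m⊥n m⊥o (suc k) =
  subst (Coprime m) (sym (*-assoc n (n ^ k) o)) (coprime-*ʳ m⊥n (coprime-^-*ʳ m⊥n m⊥o k))

CoprimePart : ℕ → ℕ → Set
CoprimePart t b = ∃₂ λ k s → Coprime s t × b ∣ t ^ k * s

coprime-part : ∀ t b .{{_ : NonZero b}} → CoprimePart t b
coprime-part t b = <-rec (λ b → .{{NonZero b}} → CoprimePart t b) step b
  where
  step : ∀ b → (∀ {b′} → b′ < b → .{{NonZero b′}} → CoprimePart t b′) →
         .{{NonZero b}} → CoprimePart t b
  step b rec with coprime? b t
  ... | yes b⊥t = 0 , b , b⊥t , ∣-reflexive (sym (*-identityˡ b))
  ... | no ¬b⊥t = extend (rec (quotient-< g∣b {{n>1⇒nonTrivial g>1}}) {{quotient≢0 g∣b}})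
    where
    g = gcd b t
    g∣b = gcd[m,n]∣m b t
    g>1 : 1 < g
    g>1 with g in eq
    ... | zero        = contradiction (gcd[m,n]≡0⇒m≡0 eq) (≢-nonZero⁻¹ b)
    ... | suc zero    = ⊥-elim (¬b⊥t (gcd≡1⇒coprime eq))
    ... | suc (suc _) = s≤s (s≤s z≤n)
    extend : CoprimePart t (quotient g∣b) → CoprimePart t b
    extend (k , s , s⊥t , b/g∣tᵏs) = suc k , s , s⊥t ,
      subst₂ _∣_ (sym (m∣n⇒n≡m*quotient g∣b)) (sym (*-assoc t (t ^ k) s))
        (*-pres-∣ (gcd[m,n]∣n b t) b/g∣tᵏs)

-- t + s * c is coprime to t (as t ⊥ c and t ⊥ s) and to s (as s ⊥ t),
-- hence to t ^ k * s, a multiple of b.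
coprime-in-residue-class : ∀ {t c} → Coprime t c → ∀ b .{{_ : NonZero b}} →
                           ∃ λ k → Coprime (t + k * c) b
coprime-in-residue-class {t} {c} t⊥c b with coprime-part t b
... | k , s , s⊥t , b∣tᵏs = s , λ (i∣t′ , i∣b) → t′⊥tᵏs k (i∣t′ , ∣-trans i∣b b∣tᵏs)
  where
  t′ = t + s * c
  t′⊥s : Coprime t′ s
  t′⊥s {i} (i∣t′ , i∣s) =
    s⊥t (i∣s , ∣m+n∣m⇒∣n (subst (i ∣_) (+-comm t (s * c)) i∣t′) (∣m⇒∣m*n c i∣s))
  t′⊥t : Coprime t′ t
  t′⊥t (i∣t′ , i∣t) = coprime-*ʳ (Coprimality.sym s⊥t) t⊥c (i∣t , ∣m+n∣m⇒∣n i∣t′ i∣t)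
  t′⊥tᵏs : ∀ k → Coprime t′ (t ^ k * s)
  t′⊥tᵏs = coprime-^-*ʳ t′⊥t t′⊥s

m*n÷n≡m : ∀ m n .{{_ : NonZero n}} → (m * n) ÷ n ≡ m
m*n÷n≡m m (suc n) = m*n/n≡m m (suc n)

-- Least positive witnesses

record LeastPositive (P : ℕ → Set) (n : ℕ) : Set where
  field
    positive : 0 < n
    holds    : P n
    minimal  : ∀ {j} → 0 < j → j < n → ¬ P j

leastPositive : ∀ {P : ℕ → Set} → Decidable P → ∀ {n} → 0 < n → P n → ∃ (LeastPositive P)
leastPositive {P} P? = <-rec (λ n → 0 < n → P n → ∃ (LeastPositive P)) step _
  where
  step : ∀ n → (∀ {j} → j < n → 0 < j → P j → ∃ (LeastPositive P)) →
         0 < n → P n → ∃ (LeastPositive P)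
  step n rec 0<n Pn with anyUpTo? (λ j → (0 <? j) ×-dec P? j) n
  ... | yes (j , j<n , 0<j , Pj) = rec j<n 0<j Pj
  ... | no ∄j = n , record
    { positive = 0<n ; holds = Pn ; minimal = λ 0<j j<n Pj → ∄j (_ , j<n , 0<j , Pj) }

leastPositive-unique : ∀ {P m n} → LeastPositive P m → LeastPositive P n → m ≡ n
leastPositive-unique {m = m} {n} lm ln with <-cmp m n
... | tri< m<n _ _ = contradiction (holds lm) (minimal ln (positive lm) m<n)
  where open LeastPositive
... | tri≈ _ m≡n _ = m≡n
... | tri> _ _ n<m = contradiction (holds ln) (minimal lm (positive ln) n<m)
  where open LeastPositive

leastPositive-∣ : ∀ {P m} → LeastPositive P m → (∀ r q → P (r + q * m) → P r) →
                  ∀ {n} → P n → m ∣ n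
leastPositive-∣ {P} {m} lm reduce {n} Pn = m%n≡0⇒n∣m n m n%m≡0
  where
  open LeastPositive lm
  instance _ = >-nonZero positive
  P[n%m] : P (n % m)
  P[n%m] = reduce (n % m) (n / m) (subst P (m≡m%n+[m/n]*n n m) Pn)
  n%m≡0 : n % m ≡ 0
  n%m≡0 with n % m ≟ 0
  ... | yes n%m≡0 = n%m≡0
  ... | no n%m≢0 = contradiction P[n%m] (minimal (n≢0⇒n>0 n%m≢0) (m%n<n n m))

-- Sizes of finite subsets

x∉p-x : ∀ {n} (p : Subset n) x → x ∉ p - x
x∉p-x (s ∷ p) zero ()
x∉p-x (s ∷ p) (suc x) (there x∈p-x) = x∉p-x p x x∈p-x

∣p∣≡1+∣p-x∣ : ∀ {n} {p : Subset n} {x} → x ∈ p → ∣ p ∣ ≡ suc ∣ p - x ∣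
∣p∣≡1+∣p-x∣ {p = inside ∷ p} {zero} here = cong (suc ∘ ∣_∣) (sym (p─⊥≡p p))
∣p∣≡1+∣p-x∣ {p = inside ∷ p} {suc x} (there x∈p) = cong suc (∣p∣≡1+∣p-x∣ x∈p)
∣p∣≡1+∣p-x∣ {p = outside ∷ p} {suc x} (there x∈p) = ∣p∣≡1+∣p-x∣ x∈p

∣image∣≡d : ∀ {n d} (f : Fin d → Fin n) → Injective _≡_ _≡_ f →
            ∀ (S : Subset n) → (∀ y → y ∈ S ⇔ ∃ λ i → f i ≡ y) → ∣ S ∣ ≡ d
∣image∣≡d {n} {zero} f _ S S≡im =
  trans (cong ∣_∣ (Empty-unique λ (y , y∈S) → ∉im y y∈S)) (∣⊥∣≡0 n)
  where
  ∉im : ∀ y → y ∉ S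
  ∉im y y∈S with Equivalence.to (S≡im y) y∈S
  ... | () , _
∣image∣≡d {n} {suc d} f f-inj S S≡im =
  trans (∣p∣≡1+∣p-x∣ (f∈S zero))
        (cong suc (∣image∣≡d (f ∘ suc) (Fin.suc-injective ∘ f-inj) (S - f zero) S-f0≡im))
  where
  f∈S : ∀ i → f i ∈ S
  f∈S i = Equivalence.from (S≡im (f i)) (i , refl)
  S-f0≡im : ∀ y → y ∈ S - f zero ⇔ ∃ λ i → f (suc i) ≡ y
  S-f0≡im y = mk⇔ to from
    where
    to : y ∈ S - f zero → ∃ λ i → f (suc i) ≡ y
    to y∈ with Equivalence.to (S≡im y) (p─q⊆p S _ y∈)
    ... | zero , refl = contradiction y∈ (x∉p-x S (f zero))
    ... | suc i , fi≡y = i , fi≡y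
    from : (∃ λ i → f (suc i) ≡ y) → y ∈ S - f zero
    from (i , refl) = x∈p∧x≢y⇒x∈p-y (f∈S (suc i)) (Fin.0≢1+n ∘ sym ∘ f-inj)

-- Powers and orders in a finite group

module _ (G : FiniteGroup) where

  open FiniteGroup G using (order; isGroup)

  group : Group 0ℓ 0ℓ
  group = record { isGroup = isGroup }

  open Group group using (_∙_; ε; _⁻¹; _//_; assoc; identityˡ; identityʳ)
  open import Algebra.Properties.Group group
    using (inverseʳ-unique; inverseˡ-unique; identityʳ-unique; //-rightDividesʳ)
  open ≡-Reasoning

  infixl 8 _^′_
  _^′_ : Fin order → ℕ → Fin order
  g ^′ n = pow G g n

  pow-+ : ∀ g m n → g ^′ (m + n) ≡ g ^′ m ∙ g ^′ n
  pow-+ g zero    n = sym (identityˡ _)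
  pow-+ g (suc m) n = trans (cong (g ∙_) (pow-+ g m n)) (sym (assoc g _ _))

  pow-* : ∀ g m n → g ^′ (m * n) ≡ (g ^′ m) ^′ n
  pow-* g m zero    = cong (g ^′_) (*-zeroʳ m)
  pow-* g m (suc n) = begin
    g ^′ (m * suc n)        ≡⟨ cong (g ^′_) (*-suc m n) ⟩
    g ^′ (m + m * n)        ≡⟨ pow-+ g m (m * n) ⟩
    g ^′ m ∙ g ^′ (m * n)   ≡⟨ cong (g ^′ m ∙_) (pow-* g m n) ⟩
    g ^′ m ∙ (g ^′ m) ^′ n  ∎

  pow-comm : ∀ g m n → (g ^′ m) ^′ n ≡ (g ^′ n) ^′ m
  pow-comm g m n = trans (sym (pow-* g m n)) (trans (cong (g ^′_) (*-comm m n)) (pow-* g n m))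

  ε-pow : ∀ n → ε ^′ n ≡ ε
  ε-pow zero    = refl
  ε-pow (suc n) = trans (identityˡ _) (ε-pow n)

  pow-+-* : ∀ g r q m → g ^′ (r + q * m) ≡ g ^′ r ∙ (g ^′ m) ^′ q
  pow-+-* g r q m = begin
    g ^′ (r + q * m)        ≡⟨ pow-+ g r (q * m) ⟩
    g ^′ r ∙ g ^′ (q * m)   ≡⟨ cong (λ e → g ^′ r ∙ g ^′ e) (*-comm q m) ⟩
    g ^′ r ∙ g ^′ (m * q)   ≡⟨ cong (g ^′ r ∙_) (pow-* g m q) ⟩
    g ^′ r ∙ (g ^′ m) ^′ q  ∎

  pow-pow-ε : ∀ g m n → g ^′ n ≡ ε → (g ^′ m) ^′ n ≡ ε
  pow-pow-ε g m n gⁿ≡ε = trans (pow-comm g m n) (trans (cong (_^′ m) gⁿ≡ε) (ε-pow m))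

  pow-periodic : ∀ {g m} → g ^′ m ≡ ε → ∀ r q → g ^′ (r + q * m) ≡ g ^′ r
  pow-periodic {g} {m} gᵐ≡ε r q = begin
    g ^′ (r + q * m)        ≡⟨ pow-+-* g r q m ⟩
    g ^′ r ∙ (g ^′ m) ^′ q  ≡⟨ cong (g ^′ r ∙_) (trans (cong (_^′ q) gᵐ≡ε) (ε-pow q)) ⟩
    g ^′ r ∙ ε              ≡⟨ identityʳ _ ⟩
    g ^′ r                  ∎

  pow-cancel : ∀ g m c → g ^′ m ≡ g ^′ (m + c) → g ^′ c ≡ ε
  pow-cancel g m c e = identityʳ-unique (g ^′ m) (g ^′ c) (trans (sym (pow-+ g m c)) (sym e))

  ⁻¹≡pow : ∀ g n → g ^′ suc n ≡ ε → g ⁻¹ ≡ g ^′ n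
  ⁻¹≡pow g n e = sym (inverseʳ-unique g (g ^′ n) e)

  HasOrder : Fin order → ℕ → Set
  HasOrder g = LeastPositive (λ n → g ^′ n ≡ ε)

  order-exists : ∀ g → ∃ (HasOrder g)
  order-exists g with pigeonhole (n<1+n order) (λ i → g ^′ toℕ i)
  ... | i , j , i<j , gⁱ≡gʲ = leastPositive (λ n → g ^′ n Fin.≟ ε) (m<n⇒0<n∸m i<j)
          (pow-cancel g (toℕ i) _ (trans gⁱ≡gʲ (cong (g ^′_) (sym (m+[n∸m]≡n (<⇒≤ i<j))))))

  module _ {g d} (o : HasOrder g d) where
    open LeastPositive o renaming (holds to gᵈ≡ε)

    order-∣ : ∀ {n} → g ^′ n ≡ ε → d ∣ n
    order-∣ = leastPositive-∣ o λ r q e → trans (sym (pow-periodic gᵈ≡ε r q)) e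

    pow-reduce : ∀ n → ∃ λ r → r < d × g ^′ r ≡ g ^′ n
    pow-reduce n = n % d , m%n<n n d ,
      trans (sym (pow-periodic gᵈ≡ε (n % d) (n / d))) (cong (g ^′_) (sym (m≡m%n+[m/n]*n n d)))
      where instance _ = >-nonZero positive

    pow-injective-≤ : ∀ {m n} → m ≤ n → n < d → g ^′ m ≡ g ^′ n → m ≡ n
    pow-injective-≤ {m} m≤n n<d gᵐ≡gⁿ with m≤n⇒∃[o]m+o≡n m≤n
    ... | zero  , m+0≡n = trans (sym (+-identityʳ m)) m+0≡n
    ... | suc c , refl  =
      contradiction (order-∣ (pow-cancel g m (suc c) gᵐ≡gⁿ)) (>⇒∤ (≤-<-trans (m≤n+m (suc c) m) n<d))

    pow-injective : ∀ {m n} → m < d → n < d → g ^′ m ≡ g ^′ n → m ≡ n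
    pow-injective {m} {n} m<d n<d gᵐ≡gⁿ with ≤-total m n
    ... | inj₁ m≤n = pow-injective-≤ m≤n n<d gᵐ≡gⁿ
    ... | inj₂ n≤m = sym (pow-injective-≤ n≤m m<d (sym gᵐ≡gⁿ))

    ∣generated∣≡order : ∀ {S} → GeneratedBy G g S → ∣ S ∣ ≡ d
    ∣generated∣≡order {S} S≡⟨g⟩ =
      ∣image∣≡d (λ i → g ^′ toℕ i) (toℕ-injective ∘ pow-injective (toℕ<n _) (toℕ<n _)) S S≡im
      where
      S≡im : ∀ y → y ∈ S ⇔ ∃ λ (i : Fin d) → g ^′ toℕ i ≡ y
      S≡im y = mk⇔ to from
        where
        to : y ∈ S → ∃ λ (i : Fin d) → g ^′ toℕ i ≡ y
        to y∈S with Equivalence.to (S≡⟨g⟩ y) y∈S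
        ... | n , gⁿ≡y with pow-reduce n
        ... | r , r<d , gʳ≡gⁿ =
          fromℕ< r<d , trans (cong (g ^′_) (toℕ-fromℕ< r<d)) (trans gʳ≡gⁿ gⁿ≡y)
        from : (∃ λ (i : Fin d) → g ^′ toℕ i ≡ y) → y ∈ S
        from (i , e) = Equivalence.from (S≡⟨g⟩ y) (toℕ i , e)

  generator-order : ∀ {g S} → GeneratedBy G g S → HasOrder g ∣ S ∣
  generator-order {g} S≡⟨g⟩ with order-exists g
  ... | d , o rewrite ∣generated∣≡order o S≡⟨g⟩ = o

  order-of-pow : ∀ {h m q} → HasOrder h (m * q) → 0 < m → HasOrder (h ^′ m) q
  order-of-pow {h} {m} {q} o 0<m = record
    { positive = >-nonZero⁻¹ q {{m*n≢0⇒n≢0 m}}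
    ; holds    = trans (sym (pow-* h m q)) holds
    ; minimal  = λ {j} 0<j j<q hᵐʲ≡ε →
        minimal (subst (_< m * j) (*-zeroʳ m) (*-monoʳ-< m 0<j)) (*-monoʳ-< m j<q)
                (trans (pow-* h m j) hᵐʲ≡ε)
    }
    where
    open LeastPositive o
    instance
      m*q≢0 = >-nonZero positive
      m≢0   = >-nonZero 0<m

  same-order⇒coprime : ∀ {w q t} → HasOrder w q → HasOrder (w ^′ t) q → Coprime t q
  same-order⇒coprime {w} ow owᵗ {i} (divides t′ refl , divides q′ refl) =
    ∣1⇒≡1 (*-cancelˡ-∣ q′ (subst (q′ * i ∣_) (sym (*-identityʳ q′)) (order-∣ owᵗ [wᵗ]^q′≡ε)))
    where
    instance _ = m*n≢0⇒m≢0 q′ {{>-nonZero (LeastPositive.positive ow)}}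
    [wᵗ]^q′≡ε : (w ^′ (t′ * i)) ^′ q′ ≡ ε
    [wᵗ]^q′≡ε = begin
      (w ^′ (t′ * i)) ^′ q′  ≡⟨ sym (pow-* w (t′ * i) q′) ⟩
      w ^′ (t′ * i * q′)     ≡⟨ cong (w ^′_) (*-assoc t′ i q′) ⟩
      w ^′ (t′ * (i * q′))   ≡⟨ cong (λ e → w ^′ (t′ * e)) (*-comm i q′) ⟩
      w ^′ (t′ * (q′ * i))   ≡⟨ pow-* w t′ (q′ * i) ⟩
      (w ^′ t′) ^′ (q′ * i)  ≡⟨ pow-pow-ε w t′ (q′ * i) (LeastPositive.holds ow) ⟩
      ε                      ∎

  pow-coprime-regenerates : ∀ {h b t} → HasOrder h b → Coprime t b →
                            ∃ λ u → (h ^′ t) ^′ u ≡ h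
  pow-coprime-regenerates {h} {b} {t} o t⊥b with coprime-Bézout t⊥b
  ... | Bézout.+- x y 1+yb≡xt = x , (begin
    (h ^′ t) ^′ x      ≡⟨ sym (pow-* h t x) ⟩
    h ^′ (t * x)       ≡⟨ cong (h ^′_) (trans (*-comm t x) (sym 1+yb≡xt)) ⟩
    h ^′ (1 + y * b)   ≡⟨ pow-periodic holds 1 y ⟩
    h ∙ ε              ≡⟨ identityʳ h ⟩
    h                  ∎)
    where open LeastPositive o
  ... | Bézout.-+ x y 1+xt≡yb = x * pred b , (begin
    (h ^′ t) ^′ (x * pred b)  ≡⟨ pow-* (h ^′ t) x (pred b) ⟩
    v ^′ pred b               ≡⟨ sym (⁻¹≡pow v (pred b) vᵇ≡ε) ⟩
    v ⁻¹                      ≡⟨ sym (inverseˡ-unique h v h∙v≡ε) ⟩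
    h                         ∎)
    where
    open LeastPositive o
    instance _ = >-nonZero positive
    v = (h ^′ t) ^′ x
    vᵇ≡ε : v ^′ suc (pred b) ≡ ε
    vᵇ≡ε = trans (cong (v ^′_) (suc-pred b)) (pow-pow-ε (h ^′ t) x b (pow-pow-ε h t b holds))
    h∙v≡ε : h ∙ v ≡ ε
    h∙v≡ε = begin
      h ∙ (h ^′ t) ^′ x  ≡⟨ cong (h ∙_) (trans (sym (pow-* h t x)) (cong (h ^′_) (*-comm t x))) ⟩
      h ^′ (1 + x * t)   ≡⟨ cong (h ^′_) 1+xt≡yb ⟩
      h ^′ (y * b)       ≡⟨ pow-periodic holds 0 y ⟩
      ε                  ∎

  -- Subgroups of cyclic groups

  pow-∈ : ∀ {D} → IsSubgroup G D → ∀ {y} → y ∈ D → ∀ n → y ^′ n ∈ D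
  pow-∈ (ε∈D , _ , _) y∈D zero = ε∈D
  pow-∈ D≤G@(_ , ∙-closed , _) y∈D (suc n) = ∙-closed y∈D (pow-∈ D≤G y∈D n)

  mutual-powers-generate : ∀ {h g S} → GeneratedBy G h S →
                           (∃ λ t → h ^′ t ≡ g) → (∃ λ u → g ^′ u ≡ h) → GeneratedBy G g S
  mutual-powers-generate {h} {g} {S} S≡⟨h⟩ (t , hᵗ≡g) (u , gᵘ≡h) y = mk⇔ to from
    where
    to : y ∈ S → ∃ λ n → g ^′ n ≡ y
    to y∈S with Equivalence.to (S≡⟨h⟩ y) y∈S
    ... | n , hⁿ≡y = u * n , trans (pow-* g u n) (trans (cong (_^′ n) gᵘ≡h) hⁿ≡y)
    from : (∃ λ n → g ^′ n ≡ y) → y ∈ S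
    from (n , gⁿ≡y) =
      Equivalence.from (S≡⟨h⟩ y) (t * n , trans (pow-* h t n) (trans (cong (_^′ n) hᵗ≡g) gⁿ≡y))

  least-exponent-∣ : ∀ {h D m} → IsSubgroup G D → LeastPositive (λ n → h ^′ n ∈ D) m →
                     ∀ {n} → h ^′ n ∈ D → m ∣ n
  least-exponent-∣ {h} {D} {m} D≤G@(_ , ∙-closed , ⁻¹-closed) lm =
    leastPositive-∣ lm λ r q hʳ⁺ᵠᵐ∈D →
      subst (_∈ D) (trans (cong (_// (h ^′ m) ^′ q) (pow-+-* h r q m)) (//-rightDividesʳ _ _))
            (∙-closed hʳ⁺ᵠᵐ∈D (⁻¹-closed (pow-∈ D≤G (LeastPositive.holds lm) q)))

  least-exponent-generates : ∀ {h S D m} → GeneratedBy G h S → IsSubgroup G D → D ⊆ S →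
                             LeastPositive (λ n → h ^′ n ∈ D) m → GeneratedBy G (h ^′ m) D
  least-exponent-generates {h} {S} {D} {m} S≡⟨h⟩ D≤G D⊆S lm y = mk⇔ to from
    where
    to : y ∈ D → ∃ λ k → (h ^′ m) ^′ k ≡ y
    to y∈D with Equivalence.to (S≡⟨h⟩ y) (D⊆S y∈D)
    ... | n , hⁿ≡y with least-exponent-∣ D≤G lm {n} (subst (_∈ D) (sym hⁿ≡y) y∈D)
    ... | divides k refl = k , trans (sym (pow-* h m k)) (trans (cong (h ^′_) (*-comm m k)) hⁿ≡y)
    from : (∃ λ k → (h ^′ m) ^′ k ≡ y) → y ∈ D
    from (k , e) = subst (_∈ D) e (pow-∈ D≤G (LeastPositive.holds lm) k)

  generator-power-index : ∀ {h a D m} → HasOrder h a → GeneratedBy G (h ^′ m) D →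
                          0 < m → m ∣ a → m ≡ a ÷ ∣ D ∣
  generator-power-index {h} {D = D} {m} o D≡⟨hᵐ⟩ 0<m (divides q refl) = begin
    m                ≡⟨ sym (m*n÷n≡m m q) ⟩
    (m * q) ÷ q      ≡⟨ cong₂ _÷_ (*-comm m q) q≡∣D∣ ⟩
    (q * m) ÷ ∣ D ∣  ∎
    where
    hᵐ-order : HasOrder (h ^′ m) q
    hᵐ-order = order-of-pow (subst (HasOrder h) (*-comm q m) o) 0<m
    instance _ = >-nonZero (LeastPositive.positive hᵐ-order)
    q≡∣D∣ : q ≡ ∣ D ∣
    q≡∣D∣ = leastPositive-unique hᵐ-order (generator-order D≡⟨hᵐ⟩)

  cyclic-subgroup-generator : ∀ {h S D} → GeneratedBy G h S → IsSubgroup G D → D ⊆ S →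
                              GeneratedBy G (h ^′ (∣ S ∣ ÷ ∣ D ∣)) D
  cyclic-subgroup-generator {h} {S} {D} S≡⟨h⟩ D≤G D⊆S =
    subst (λ k → GeneratedBy G (h ^′ k) D)
          (generator-power-index h-order D≡⟨hᵐ⟩ (LeastPositive.positive lm)
                                 (least-exponent-∣ D≤G lm hᵃ∈D))
          D≡⟨hᵐ⟩
    where
    h-order : HasOrder h ∣ S ∣
    h-order = generator-order S≡⟨h⟩
    hᵃ∈D : h ^′ ∣ S ∣ ∈ D
    hᵃ∈D = subst (_∈ D) (sym (LeastPositive.holds h-order)) (proj₁ D≤G)
    least : ∃ (LeastPositive (λ n → h ^′ n ∈ D))
    least = leastPositive (λ n → h ^′ n ∈? D) (LeastPositive.positive h-order) hᵃ∈D
    lm : LeastPositive (λ n → h ^′ n ∈ D) (proj₁ least)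
    lm = proj₂ least
    D≡⟨hᵐ⟩ : GeneratedBy G (h ^′ proj₁ least) D
    D≡⟨hᵐ⟩ = least-exponent-generates S≡⟨h⟩ D≤G D⊆S lm

  compatible-generator : ∀ {h z B D} → GeneratedBy G h B → IsSubgroup G D → D ⊆ B →
                         GeneratedBy G z D →
                         ∃ λ g → GeneratedBy G g B × g ^′ (∣ B ∣ ÷ ∣ D ∣) ≡ z
  compatible-generator {h} {z} {B} {D} B≡⟨h⟩ D≤G D⊆B D≡⟨z⟩ = h ^′ t′ , B≡⟨hᵗ′⟩ , [hᵗ′]ᵐ≡z
    where
    m : ℕ
    m = ∣ B ∣ ÷ ∣ D ∣
    w : Fin order
    w = h ^′ m
    D≡⟨w⟩ : GeneratedBy G w D
    D≡⟨w⟩ = cyclic-subgroup-generator B≡⟨h⟩ D≤G D⊆B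
    h-order : HasOrder h ∣ B ∣
    h-order = generator-order B≡⟨h⟩
    w-order : HasOrder w ∣ D ∣
    w-order = generator-order D≡⟨w⟩
    z-as-pow : ∃ λ t → w ^′ t ≡ z
    z-as-pow = Equivalence.to (D≡⟨w⟩ z) (Equivalence.from (D≡⟨z⟩ z) (1 , identityʳ z))
    t : ℕ
    t = proj₁ z-as-pow
    t⊥∣D∣ : Coprime t ∣ D ∣
    t⊥∣D∣ = same-order⇒coprime w-order
              (subst (λ x → HasOrder x ∣ D ∣) (sym (proj₂ z-as-pow)) (generator-order D≡⟨z⟩))
    instance _ = >-nonZero (LeastPositive.positive h-order)
    shift : ∃ λ k → Coprime (t + k * ∣ D ∣) ∣ B ∣
    shift = coprime-in-residue-class t⊥∣D∣ ∣ B ∣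
    t′ : ℕ
    t′ = t + proj₁ shift * ∣ D ∣
    [hᵗ′]ᵐ≡z : (h ^′ t′) ^′ m ≡ z
    [hᵗ′]ᵐ≡z = begin
      (h ^′ t′) ^′ m  ≡⟨ pow-comm h t′ m ⟩
      w ^′ t′         ≡⟨ pow-periodic (LeastPositive.holds w-order) t (proj₁ shift) ⟩
      w ^′ t          ≡⟨ proj₂ z-as-pow ⟩
      z               ∎
    B≡⟨hᵗ′⟩ : GeneratedBy G (h ^′ t′) B
    B≡⟨hᵗ′⟩ = mutual-powers-generate B≡⟨h⟩ (t′ , refl)
                (pow-coprime-regenerates {t = t′} h-order (proj₂ shift))

lemma3p6 : (G : FiniteGroup) →
    ¬ IsCyclicGroup G →
    (k : ℕ) (C : Fin k → Subset (FiniteGroup.order G)) →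
    Injective _≡_ _≡_ C →
    (∀ i → IsMuSubgroup G (C i)) →
    (∀ H → IsMuSubgroup G H → ∃ λ i → H ≡ C i) →
    (C₀ : Subset (FiniteGroup.order G)) →
    IsSubgroup G C₀ →
    (∀ i j → i ≢ j → (C i ∩ C j) ≡ C₀) →
    Σ (Fin k → Fin (FiniteGroup.order G)) λ g →
      (∀ i → GeneratedBy G (g i) (C i))
      × (∀ i j → pow G (g i) (∣ C i ∣ ÷ ∣ C₀ ∣) ≡ pow G (g j) (∣ C j ∣ ÷ ∣ C₀ ∣))
lemma3p6 G _ zero C _ _ _ C₀ _ _ = (λ ()) , (λ ()) , (λ ())
lemma3p6 G _ (suc k) C _ μ _ C₀ C₀≤G petals-meet =
  g , Cᵢ≡⟨gᵢ⟩ , λ i j → trans (gᵢᵐ≡z i) (sym (gᵢᵐ≡z j))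
  where
  cyclic : ∀ i → IsCyclicSubgroup G (C i)
  cyclic i = proj₁ (μ i)
  h : Fin (FiniteGroup.order G)
  h = proj₁ (cyclic zero)
  z : Fin (FiniteGroup.order G)
  z = pow G h (∣ C zero ∣ ÷ ∣ C₀ ∣)
  C₀⊆ : ∀ {i} j → i ≢ j → C₀ ⊆ C i
  C₀⊆ {i} j i≢j = p∩q⊆p (C i) (C j) ∘ subst (_ ∈_) (sym (petals-meet i j i≢j))
  compatible : ∀ i → ∃ λ g → GeneratedBy G g (C i) × pow G g (∣ C i ∣ ÷ ∣ C₀ ∣) ≡ z
  compatible i with i Fin.≟ zero
  ... | yes refl = h , proj₂ (cyclic zero) , refl
  ... | no i≢0   = compatible-generator G (proj₂ (cyclic i)) C₀≤G (C₀⊆ zero i≢0)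
                     (cyclic-subgroup-generator G (proj₂ (cyclic zero)) C₀≤G (C₀⊆ i (i≢0 ∘ sym)))
  g : Fin (suc k) → Fin (FiniteGroup.order G)
  g i = proj₁ (compatible i)
  Cᵢ≡⟨gᵢ⟩ : ∀ i → GeneratedBy G (g i) (C i)
  Cᵢ≡⟨gᵢ⟩ i = proj₁ (proj₂ (compatible i))
  gᵢᵐ≡z : ∀ i → pow G (g i) (∣ C i ∣ ÷ ∣ C₀ ∣) ≡ z
  gᵢᵐ≡z i = proj₂ (proj₂ (compatible i))
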